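{- Let $G$ be a strongly connected almost bunchy graph. If $G$ is not bunchy, then $\sim_G$ is nontrivial (i.e. there are distinct states $J_1\neq J_2$ with $J_1\sim_G J_2$).
   Context: All graphs are finite directed graphs with state set $V(G)$, edge set $E(G)$, source/target maps $s,t$; loops and parallel edges allowed; all graphs sink-free. $E_I(G)=s^{ -1}(I)$, $F(I)=t(E_I(G))$, $L_I(G)$ finite edge paths starting at $I$. Strongly connected: there is a path from any state to any state. A homomorphism consists of maps on edges and ($\partial\Phi$) on states commuting with $s,t$. A right-resolver is a surjective homomorphism with $\Phi|_{E_I(G)}:E_I(G)\to E_{\partial\Phi(I)}(H)$ bijective for all $I$. $M(G)$ is the unique $\leq_R$-minimal graph admitting a right-resolver from $G$; all right-resolvers $G\to M(G)$ share the state map $\Sigma_G$. A state $I$ is bunchy if $\Sigma_G|_{F(I)}:F(I)\to F(\Sigma_G(I))$ is a bijection; $G$ is bunchy if all states are. $G$ is almost bunchy if for each $I,J\in V(M(G))$ there is at most one $I'\in\Sigma_G^{ -1}(I)$ with $|F(I')\cap\Sigma_G^{ -1}(J)|\geq 2$. For a right-resolver $\Phi:G\to H$ and $u\in L_{\partial\Phi(I)}(H)$, $I\cdot u$ is the endpoint of the unique lift of $u$ starting at $I$; $I_1\sim_\Phi I_2$ iff $\partial\Phi(I_1)=\partial\Phi(I_2)=:I$ and for every $u\in L_I(H)$ there is $v\in L_{t(u)}(H)$ with $I_1\cdot uv=I_2\cdot uv$. For almost bunchy $G$ this relation is the same for all right-resolvers $\Phi:G\to M(G)$, and is denoted $\sim_G$.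 -}

module Defs where

open import Data.Nat using (ℕ)
open import Data.Fin using (Fin)
open import Data.List using (List; []; _∷_; map; _++_)
open import Data.Product using (Σ; ∃; ∃-syntax; _×_; _,_)
open import Relation.Binary.PropositionalEquality using (_≡_; _≢_)
open import Relation.Nullary using (¬_)
open import Data.Unit using (⊤)

record Graph : Set where
  field
    nV : ℕ
    nE : ℕ
    s  : Fin nE → Fin nV
    t  : Fin nE → Fin nV
    sinkFree : ∀ (I : Fin nV) → ∃[ e ] s e ≡ I

open Graph public

State : Graph → Set
State G = Fin (nV G)

Edge : Graph → Set
Edge G = Fin (nE G)

IsPathFrom : (G : Graph) → State G → List (Edge G) → Set
IsPathFrom G I []      = ⊤
IsPathFrom G I (e ∷ p) = (s G e ≡ I) × IsPathFrom G (t G e) p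

endState : (G : Graph) → State G → List (Edge G) → State G
endState G I []      = I
endState G I (e ∷ p) = endState G (t G e) p

StronglyConnected : Graph → Set
StronglyConnected G =
  ∀ (I J : State G) → ∃[ p ] (IsPathFrom G I p × endState G I p ≡ J)

record Hom (G H : Graph) : Set where
  field
    φ  : Edge G → Edge H
    ∂φ : State G → State H
    s-comm : ∀ e → s H (φ e) ≡ ∂φ (s G e)
    t-comm : ∀ e → t H (φ e) ≡ ∂φ (t G e)

open Hom public

record RightResolver (G H : Graph) : Set where
  field
    hom : Hom G H
    surjE : ∀ (f : Edge H) → ∃[ e ] φ hom e ≡ f
    surjV : ∀ (K : State H) → ∃[ I ] ∂φ hom I ≡ K
    resolveInj : ∀ (I : State G) (e e' : Edge G) → s G e ≡ I → s G e' ≡ I →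
                 φ hom e ≡ φ hom e' → e ≡ e'
    resolveSurj : ∀ (I : State G) (f : Edge H) → s H f ≡ ∂φ hom I →
                  ∃[ e ] (s G e ≡ I × φ hom e ≡ f)

open RightResolver public

_≤R_ : Graph → Graph → Set
H ≤R H' = RightResolver H' H

-- H is (a copy of) M(G): H is ≤_R-minimal among graphs admitting a right-resolver from G
IsMinimalRRFactor : Graph → Graph → Set
IsMinimalRRFactor G H =
  RightResolver G H ×
  (∀ (H' : Graph) → RightResolver G H' → H' ≤R H → H ≤R H')

module _ {G H : Graph} (Φ : RightResolver G H) where

  private
    Σ' : State G → State H
    Σ' = ∂φ (hom Φ)

  InF : State G → State G → Set
  InF I K = ∃[ e ] (s G e ≡ I × t G e ≡ K)

  InFH : State H → State H → Set
  InFH I K = ∃[ f ] (s H f ≡ I × t H f ≡ K)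

  BunchyState : State G → Set
  BunchyState I =
    (∀ K K' → InF I K → InF I K' → Σ' K ≡ Σ' K' → K ≡ K') ×
    (∀ L → InFH (Σ' I) L → ∃[ K ] (InF I K × Σ' K ≡ L))

  Bunchy : Set
  Bunchy = ∀ (I : State G) → BunchyState I

  AtLeastTwo : State G → State H → Set
  AtLeastTwo I' J = ∃[ K₁ ] ∃[ K₂ ]
    (K₁ ≢ K₂ × InF I' K₁ × InF I' K₂ × Σ' K₁ ≡ J × Σ' K₂ ≡ J)

  AlmostBunchy : Set
  AlmostBunchy = ∀ (I J : State H) (I₁ I₂ : State G) →
    Σ' I₁ ≡ I → Σ' I₂ ≡ I → AtLeastTwo I₁ J → AtLeastTwo I₂ J → I₁ ≡ I₂

  LiftEnd : State G → List (Edge H) → State G → Set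
  LiftEnd I u J = ∃[ p ] (IsPathFrom G I p × map (φ (hom Φ)) p ≡ u × endState G I p ≡ J)

  _∼_ : State G → State G → Set
  I₁ ∼ I₂ = Σ' I₁ ≡ Σ' I₂ ×
    (∀ (u : List (Edge H)) → IsPathFrom H (Σ' I₁) u →
       ∃[ v ] (IsPathFrom H (endState H (Σ' I₁) u) v ×
               ∃[ J ] (LiftEnd I₁ (u ++ v) J × LiftEnd I₂ (u ++ v) J)))

-- Non-bunchiness gives a state I with out-edges e₁, e₂ whose targets K₁ ≠ K₂ lie in one fibre
-- of Σ; we show K₁ ∼ K₂. Fix lifts A₀ = K₁·u and B₀ = K₂·u, and call a family of states in
-- the fibre of A₀ forcing if any two distinct members that meet (reach a common state along a
-- common word) make A₀ and B₀ meet. A forcing family with first member A grows: drive A to I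
-- along some word w and push the other members along w f₁ u. A itself reaches A₀ along w f₁ u
-- and B₀ along w f₂ u, while a member C with C·w ≠ I reaches the same state along both words,
-- since by almost bunchiness only I can split f₁, f₂ inside the fibre of K₁ (and if C·w = I,
-- C already meets A). So the pushed members together with A₀ and B₀ form a larger forcing
-- family; once it outnumbers the states two members coincide, and A₀, B₀ meet.
module Submission where

open import Defs
open import Data.Empty using (⊥-elim)
open import Data.Fin using (Fin; zero; suc; _≟_)
open import Data.Fin.Properties using (pigeonhole; <⇒≢; any?; suc-injective)
open import Data.List using (List; []; _∷_; map; _++_)
open import Data.List.Properties using (map-++)
open import Data.Nat using (ℕ; zero; suc)
open import Data.Nat.Properties using (n<1+n)
open import Data.Product using (∃-syntax; _×_; _,_; proj₁; proj₂)
open import Data.Unit using (tt)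
open import Data.Vec.Functional as Vector using ()
open import Function using (_∘_; id)
open import Relation.Binary.PropositionalEquality
  using (_≡_; _≢_; refl; sym; trans; cong; subst)
open import Relation.Nullary using (¬_; Dec; yes; no)
open import Relation.Nullary.Decidable using (_×-dec_; ¬?)

module _ {n : ℕ} (P : Fin n → Set) (R : Fin n → Fin n → Set) where

  record Family (k : ℕ) : Set where
    field
      member   : Fin k → Fin n
      member-P : ∀ i → P (member i)
      related  : ∀ i j → i ≢ j → R (member i) (member j)

  open Family

  Family-cons : (∀ {x y} → R x y → R y x) → ∀ {k x} → P x →
                (F : Family k) → (∀ i → R x (member F i)) → Family (suc k)
  Family-cons R-sym {x = x} Px F Rx = record
    { member   = x Vector.∷ member F
    ; member-P = λ { zero → Px ; (suc i) → member-P F i }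
    ; related  = λ { zero zero x≢x → ⊥-elim (x≢x refl)
                   ; zero (suc j) _ → Rx j
                   ; (suc i) zero _ → R-sym (Rx i)
                   ; (suc i) (suc j) i≢j → related F i j (i≢j ∘ cong suc) } }

  oversized-family⇒reflexive : Family (suc n) → ∃[ x ] R x x
  oversized-family⇒reflexive F
    with i , j , i<j , same ← pigeonhole (n<1+n n) (member F)
    = member F i , subst (R (member F i)) (sym same) (related F i j (<⇒≢ i<j))

  growing-family⇒reflexive : Family 1 → (∀ {k} → Family (suc k) → Family (suc (suc k))) →
                             ∃[ x ] R x x
  growing-family⇒reflexive F₁ grow = oversized-family⇒reflexive (iterate n)
    where
    iterate : ∀ m → Family (suc m)
    iterate zero    = F₁
    iterate (suc m) = grow (iterate m)

module _ (G : Graph) where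

  IsPathFrom-++ : ∀ {C} p q → IsPathFrom G C p → IsPathFrom G (endState G C p) q →
                  IsPathFrom G C (p ++ q)
  IsPathFrom-++ []      q _          q-path = q-path
  IsPathFrom-++ (e ∷ p) q (se , p-path) q-path = se , IsPathFrom-++ p q p-path q-path

  endState-++ : ∀ C p q → endState G C (p ++ q) ≡ endState G (endState G C p) q
  endState-++ C []      q = refl
  endState-++ C (e ∷ p) q = endState-++ (t G e) p q

module _ {G H : Graph} (Φ : RightResolver G H) where

  private
    Σ' : State G → State H
    Σ' = ∂φ (hom Φ)

    φ' : Edge G → Edge H
    φ' = φ (hom Φ)

  IsPathFrom-map : ∀ C p → IsPathFrom G C p → IsPathFrom H (Σ' C) (map φ' p)
  IsPathFrom-map C []      _             = tt
  IsPathFrom-map C (e ∷ p) (se , p-path) =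
    trans (s-comm (hom Φ) e) (cong Σ' se) ,
    subst (λ X → IsPathFrom H X (map φ' p)) (sym (t-comm (hom Φ) e))
          (IsPathFrom-map (t G e) p p-path)

  endState-map : ∀ C p → Σ' (endState G C p) ≡ endState H (Σ' C) (map φ' p)
  endState-map C []      = refl
  endState-map C (e ∷ p) =
    trans (endState-map (t G e) p)
          (cong (λ X → endState H X (map φ' p)) (sym (t-comm (hom Φ) e)))

  LiftEnd-path : ∀ {C y D} → LiftEnd Φ C y D → IsPathFrom H (Σ' C) y
  LiftEnd-path {C} (p , p-path , refl , refl) = IsPathFrom-map C p p-path

  LiftEnd-fibre : ∀ {C y D} → LiftEnd Φ C y D → Σ' D ≡ endState H (Σ' C) y
  LiftEnd-fibre {C} (p , _ , refl , refl) = endState-map C p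

  LiftEnd-[] : ∀ C → LiftEnd Φ C [] C
  LiftEnd-[] C = [] , tt , refl , refl

  LiftEnd-edge : ∀ {C} e → s G e ≡ C → LiftEnd Φ C (φ' e ∷ []) (t G e)
  LiftEnd-edge e se = e ∷ [] , (se , tt) , refl , refl

  LiftEnd-edge⁻¹ : ∀ {C f D} → LiftEnd Φ C (f ∷ []) D → InF Φ C D
  LiftEnd-edge⁻¹ (e ∷ [] , (se , _) , _ , refl) = e , se , refl

  LiftEnd-++ : ∀ {C y D z X} → LiftEnd Φ C y D → LiftEnd Φ D z X → LiftEnd Φ C (y ++ z) X
  LiftEnd-++ {C} (p , p-path , refl , refl) (q , q-path , refl , refl) =
    p ++ q , IsPathFrom-++ G p q p-path q-path , map-++ φ' p q , endState-++ G C p q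

  lift : ∀ C y → IsPathFrom H (Σ' C) y → ∃[ D ] LiftEnd Φ C y D
  lift C []      _             = C , LiftEnd-[] C
  lift C (f ∷ y) (sf , y-path)
    with e , se , refl ← resolveSurj Φ C f sf
    with D , lifted ← lift (t G e) y
           (subst (λ X → IsPathFrom H X y) (t-comm (hom Φ) e) y-path)
    = D , LiftEnd-++ (LiftEnd-edge e se) lifted

  LiftEnd-transfer : ∀ {C C₀ y D₀} → Σ' C ≡ Σ' C₀ → LiftEnd Φ C₀ y D₀ →
                     ∃[ D ] (LiftEnd Φ C y D × Σ' D ≡ Σ' D₀)
  LiftEnd-transfer {C} {y = y} same lifted₀
    with D , lifted ← lift C y (subst (λ X → IsPathFrom H X y) (sym same) (LiftEnd-path lifted₀))
    = D , lifted ,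
      trans (LiftEnd-fibre lifted)
            (trans (cong (λ X → endState H X y) same) (sym (LiftEnd-fibre lifted₀)))

  connected-lift : StronglyConnected G → ∀ C D → ∃[ w ] LiftEnd Φ C w D
  connected-lift connected C D with p , p-path , p-end ← connected C D =
    map φ' p , p , p-path , refl , p-end

  Meet : State G → State G → Set
  Meet C D = ∃[ v ] ∃[ X ] (LiftEnd Φ C v X × LiftEnd Φ D v X)

  Meet-refl : ∀ C → Meet C C
  Meet-refl C = [] , C , LiftEnd-[] C , LiftEnd-[] C

  Meet-sym : ∀ {C D} → Meet C D → Meet D C
  Meet-sym (v , X , C-lift , D-lift) = v , X , D-lift , C-lift

  Meet-pull : ∀ {C D C' D' y} → LiftEnd Φ C y C' → LiftEnd Φ D y D' → Meet C' D' → Meet C D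
  Meet-pull {y = y} C-lift D-lift (v , X , C'-lift , D'-lift) =
    y ++ v , X , LiftEnd-++ C-lift C'-lift , LiftEnd-++ D-lift D'-lift

  ∼-intro : ∀ {C D} → Σ' C ≡ Σ' D →
            (∀ {u A B} → LiftEnd Φ C u A → LiftEnd Φ D u B → Meet A B) → _∼_ Φ C D
  ∼-intro {C} same meet = same , λ u u-path →
    let A , A-lift = lift C u u-path
        B , B-lift , _ = LiftEnd-transfer (sym same) A-lift
        v , X , AX , BX = meet A-lift B-lift
    in v , subst (λ Y → IsPathFrom H Y v) (LiftEnd-fibre A-lift) (LiftEnd-path AX) ,
       X , LiftEnd-++ A-lift AX , LiftEnd-++ B-lift BX

  Fork : State G → Set
  Fork I = ∃[ e₁ ] ∃[ e₂ ] ((s G e₁ ≡ I × s G e₂ ≡ I) ×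
                            (Σ' (t G e₁) ≡ Σ' (t G e₂) × t G e₁ ≢ t G e₂))

  fork? : ∀ I → Dec (Fork I)
  fork? I = any? λ e₁ → any? λ e₂ →
    ((s G e₁ ≟ I) ×-dec (s G e₂ ≟ I)) ×-dec
    ((Σ' (t G e₁) ≟ Σ' (t G e₂)) ×-dec ¬? (t G e₁ ≟ t G e₂))

  ¬Fork⇒BunchyState : ∀ {I} → ¬ Fork I → BunchyState Φ I
  ¬Fork⇒BunchyState {I} no-fork = injective , surjective
    where
    injective : ∀ K K' → InF Φ I K → InF Φ I K' → Σ' K ≡ Σ' K' → K ≡ K'
    injective _ _ (e , se , refl) (e' , se' , refl) same with t G e ≟ t G e'
    ... | yes K≡K' = K≡K'
    ... | no  K≢K' = ⊥-elim (no-fork (e , e' , (se , se') , (same , K≢K')))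

    surjective : ∀ L → InFH Φ (Σ' I) L → ∃[ K ] (InF Φ I K × Σ' K ≡ L)
    surjective L (f , sf , refl) with e , se , refl ← resolveSurj Φ I f sf =
      t G e , (e , se , refl) , sym (t-comm (hom Φ) e)

  ¬Bunchy⇒Fork : ¬ Bunchy Φ → ∃[ I ] Fork I
  ¬Bunchy⇒Fork not-bunchy with any? fork?
  ... | yes fork    = fork
  ... | no  no-fork = ⊥-elim (not-bunchy λ I → ¬Fork⇒BunchyState (no-fork ∘ (I ,_)))

  module _ (connected : StronglyConnected G) (almost-bunchy : AlmostBunchy Φ)
           {I : State G} {e₁ e₂ : Edge G} (s₁ : s G e₁ ≡ I) (s₂ : s G e₂ ≡ I)
           (same-fibre : Σ' (t G e₁) ≡ Σ' (t G e₂)) (distinct : t G e₁ ≢ t G e₂) where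

    fork-determined : ∀ {C N} → C ≢ I → Σ' C ≡ Σ' I →
                      LiftEnd Φ C (φ' e₁ ∷ []) N → LiftEnd Φ C (φ' e₂ ∷ []) N
    fork-determined {C} {N} C≢I same N-lift
      with Y , Y-lift , Y-fibre ← LiftEnd-transfer same (LiftEnd-edge e₂ s₂)
      with N ≟ Y
    ... | yes refl = Y-lift
    ... | no  N≢Y  = ⊥-elim (C≢I (sym (almost-bunchy _ _ I C refl same fork-at-I fork-at-C)))
      where
      fork-at-I : AtLeastTwo Φ I (Σ' (t G e₁))
      fork-at-I = t G e₁ , t G e₂ , distinct , (e₁ , s₁ , refl) , (e₂ , s₂ , refl) ,
                  refl , sym same-fibre

      fork-at-C : AtLeastTwo Φ C (Σ' (t G e₁))
      fork-at-C = N , Y , N≢Y , LiftEnd-edge⁻¹ N-lift , LiftEnd-edge⁻¹ Y-lift ,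
                  trans (LiftEnd-fibre N-lift) (t-comm (hom Φ) e₁) , trans Y-fibre (sym same-fibre)

    module _ {u A₀ B₀} (A₀-lift : LiftEnd Φ (t G e₁) u A₀) (B₀-lift : LiftEnd Φ (t G e₂) u B₀) where

      InFibre : State G → Set
      InFibre C = Σ' C ≡ Σ' A₀

      Forces : State G → State G → Set
      Forces C D = Meet C D → Meet A₀ B₀

      Forces-sym : ∀ {C D} → Forces C D → Forces D C
      Forces-sym forces = forces ∘ Meet-sym

      B₀-fibre : InFibre B₀
      B₀-fibre = trans (LiftEnd-fibre B₀-lift)
                       (trans (cong (λ X → endState H X u) (sym same-fibre))
                              (sym (LiftEnd-fibre A₀-lift)))

      record Trajectory (w : List (Edge H)) (C : State G) : Set where
        field
          mid next end : State G
          to-mid    : LiftEnd Φ C w mid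
          mid-fibre : Σ' mid ≡ Σ' I
          to-next   : LiftEnd Φ mid (φ' e₁ ∷ []) next
          to-end    : LiftEnd Φ next u end
          end-fibre : InFibre end

      open Trajectory

      trajectory : ∀ {w A C} → LiftEnd Φ A w I → InFibre A → InFibre C → Trajectory w C
      trajectory A-to-I A-fibre C-fibre
        with M , M-lift , M-fibre ← LiftEnd-transfer (trans C-fibre (sym A-fibre)) A-to-I
        with N , N-lift , N-fibre ← LiftEnd-transfer M-fibre (LiftEnd-edge e₁ s₁)
        with E , E-lift , E-fibre ← LiftEnd-transfer N-fibre A₀-lift
        = record { to-mid = M-lift ; mid-fibre = M-fibre ; to-next = N-lift
                 ; to-end = E-lift ; end-fibre = E-fibre }

      base-trajectory : ∀ {w A} → LiftEnd Φ A w I → Trajectory w A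
      base-trajectory A-to-I = record
        { to-mid = A-to-I ; mid-fibre = refl ; to-next = LiftEnd-edge e₁ s₁
        ; to-end = A₀-lift ; end-fibre = refl }

      Trajectory-pull : ∀ {w C D} (T : Trajectory w C) (T' : Trajectory w D) →
                        Meet (end T) (end T') → Meet C D
      Trajectory-pull T T' =
        Meet-pull (to-mid T) (to-mid T') ∘ Meet-pull (to-next T) (to-next T') ∘
        Meet-pull (to-end T) (to-end T')

      -- A reaches B₀ along w f₂ u, and C reaches end T along it unless mid T ≡ I.
      Trajectory-pull-B₀ : ∀ {w A C} → LiftEnd Φ A w I → (T : Trajectory w C) →
                           Meet B₀ (end T) → Meet A C
      Trajectory-pull-B₀ {w} {C = C} A-to-I T B₀-meets with mid T ≟ I
      ... | yes mid≡I = Meet-pull A-to-I (subst (LiftEnd Φ C w) mid≡I (to-mid T)) (Meet-refl I)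
      ... | no  mid≢I =
        Meet-pull A-to-I (to-mid T)
          (Meet-pull (LiftEnd-edge e₂ s₂) (fork-determined mid≢I (mid-fibre T) (to-next T))
            (Meet-pull B₀-lift (to-end T) B₀-meets))

      grow : ∀ {k} → Family InFibre Forces (suc k) → Family InFibre Forces (suc (suc k))
      grow {k} F =
        Family-cons InFibre Forces Forces-sym refl
          (Family-cons InFibre Forces Forces-sym B₀-fibre pushed B₀-forces)
          λ { zero → id ; (suc j) → A₀-forces j }
        where
        open Family F

        w : List (Edge H)
        w = proj₁ (connected-lift connected (member zero) I)

        A-to-I : LiftEnd Φ (member zero) w I
        A-to-I = proj₂ (connected-lift connected (member zero) I)

        T : ∀ j → Trajectory w (member (suc j))
        T j = trajectory A-to-I (member-P zero) (member-P (suc j))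

        pushed : Family InFibre Forces k
        pushed = record
          { member   = end ∘ T
          ; member-P = end-fibre ∘ T
          ; related  = λ i j i≢j → related (suc i) (suc j) (i≢j ∘ suc-injective)
                                   ∘ Trajectory-pull (T i) (T j) }

        A₀-forces : ∀ j → Forces A₀ (end (T j))
        A₀-forces j = related zero (suc j) (λ ())
                      ∘ Trajectory-pull (base-trajectory A-to-I) (T j)

        B₀-forces : ∀ j → Forces B₀ (end (T j))
        B₀-forces j = related zero (suc j) (λ ()) ∘ Trajectory-pull-B₀ A-to-I (T j)

      forked-lifts-meet : Meet A₀ B₀
      forked-lifts-meet =
        let x , x-forces = growing-family⇒reflexive InFibre Forces singleton grow
        in x-forces (Meet-refl x)
        where
        singleton : Family InFibre Forces 1
        singleton = record
          { member = λ _ → A₀ ; member-P = λ _ → refl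
          ; related = λ { zero zero 0≢0 → ⊥-elim (0≢0 refl) } }

proposition5p9 : (G H : Graph) (Φ : RightResolver G H) →
    IsMinimalRRFactor G H →
    StronglyConnected G →
    AlmostBunchy Φ →
    ¬ Bunchy Φ →
    ∃[ J₁ ] ∃[ J₂ ] (J₁ ≢ J₂ × _∼_ Φ J₁ J₂)
proposition5p9 G H Φ _ connected almost-bunchy not-bunchy
  with _ , e₁ , e₂ , (s₁ , s₂) , (same-fibre , distinct) ← ¬Bunchy⇒Fork Φ not-bunchy
  = t G e₁ , t G e₂ , distinct ,
    ∼-intro Φ same-fibre (forked-lifts-meet Φ connected almost-bunchy s₁ s₂ same-fibre distinct)
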